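{- Let $k\in\mathbb{N}$ with $k\ge 2$. Then $$\max_{\substack{n\in\mathbb{N},\ d_{\mathbb{P}}(n)=k\\ 2\mid n}} j(n) \;=\; 2\,\Omega(k)+2.$$
   Context: $\mathbb{N}$ is the set of positive integers, $\mathbb{P}$ the set of primes. For $n\in\mathbb{N}$, $d_{\mathbb{P}}(n)$ is the number of distinct primes dividing $n$. The Jacobsthal function is $j(n)=\min\{m\in\mathbb{N}\mid \forall a\in\mathbb{Z}\ \exists x\in\{1,\dots,m\}: \gcd(a+x,n)=1\}$. For $k\ge 2$, $\Omega(k)$ is defined as the maximum $m\in\mathbb{N}$ for which there exist $a\in\mathbb{Z}$ and $k-1$ distinct odd primes $\pi_2,\dots,\pi_k$ such that for every $x\in\{1,\dots,m\}$ some $\pi_i$ ($2\le i\le k$) divides $a+x$. -}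

module Defs where

open import Data.Nat as ℕ using (ℕ; _≤_; _*_; _+_; _∸_)
open import Data.Nat.Divisibility using (_∣_)
open import Data.Nat.Primality using (Prime)
open import Data.Integer as ℤ using (ℤ; +_)
open import Data.Integer.GCD using (gcd)
open import Data.Integer.Divisibility as ℤD using ()
open import Data.List using (List; length)
open import Data.List.Membership.Propositional using (_∈_)
open import Data.List.Relation.Unary.All using (All)
open import Data.List.Relation.Unary.Any using (Any)
open import Data.List.Relation.Unary.Unique.Propositional using (Unique)
open import Data.Product using (Σ; ∃; _×_)
open import Function.Bundles using (_⇔_)
open import Relation.Binary.PropositionalEquality using (_≡_)
open import Relation.Nullary using (¬_)

NumDistinctPrimeDivisors : ℕ → ℕ → Set
NumDistinctPrimeDivisors n k =
  Σ (List ℕ) λ ps → Unique ps × length ps ≡ k ×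
    (∀ p → (p ∈ ps) ⇔ (Prime p × p ∣ n))

JacobsthalProp : ℕ → ℕ → Set
JacobsthalProp n m =
  ∀ (a : ℤ) → Σ ℕ λ x → 1 ≤ x × x ≤ m × gcd (a ℤ.+ + x) (+ n) ≡ + 1

IsJacobsthal : ℕ → ℕ → Set
IsJacobsthal n m =
  1 ≤ m × JacobsthalProp n m × (∀ m′ → 1 ≤ m′ → JacobsthalProp n m′ → m ≤ m′)

Odd : ℕ → Set
Odd p = ¬ (2 ∣ p)

OmegaProp : ℕ → ℕ → Set
OmegaProp k m =
  Σ ℤ λ a → Σ (List ℕ) λ ps →
    length ps ≡ k ∸ 1 × Unique ps × All (λ p → Prime p × Odd p) ps ×
    (∀ x → 1 ≤ x → x ≤ m → Any (λ p → (+ p) ℤD.∣ (a ℤ.+ + x)) ps)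

IsOmega : ℕ → ℕ → Set
IsOmega k m = 1 ≤ m × OmegaProp k m × (∀ m′ → OmegaProp k m′ → m′ ≤ m)

module Submission where

-- Let w = Ω(k), witnessed by a ∈ ℤ and k-1 distinct odd primes ps that
-- cover a+1, …, a+w (each of these integers is divisible by one of them).
--
-- Lower bound.  n = 2·∏ps is even with exactly k prime divisors, and the
-- window of length 2w+1 after 2a + ∏ps contains nothing coprime to n:
-- odd offsets give even numbers, and an even offset 2t gives
-- 2(a+t) + ∏ps, divisible by the prime covering a+t.  Hence j(n) ≥ 2w+2.
--
-- Upper bound.  Let n be even with d_P(n) = k and suppose the window of
-- length 2M after a contains nothing coprime to n.  Its M odd members
-- c+2j (1 ≤ j ≤ M) are each divisible by an odd prime divisor of n.  If
-- Q is the product of these k-1 odd primes and h·2 = Q+1, every prime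
-- dividing Q and c+2j also divides h·c+j, so they cover h·c+1, …, h·c+M
-- and M ≤ Ω(k).  For M = w+1 this is impossible, so j(n) ≤ 2w+2.

open import Defs
open import Data.Nat using (ℕ; _≤_; _*_; _+_)
open import Data.Nat.Divisibility using (_∣_)
open import Data.Product using (Σ; _×_)

open import Data.Nat using (zero; suc; _∸_; _<_; z≤n; s≤s; _≟_; _≤?_; ≢-nonZero)
import Data.Nat.Properties as ℕP
open import Data.Nat.Divisibility using (divides; ∣-refl; ∣-trans; ∣1⇒≡1; m∣m*n; ∣n⇒∣m*n; ∣m+n∣m⇒∣n)
import Data.Nat.GCD as ℕGCD
import Data.Nat.Tactic.RingSolver as ℕSolver
open import Data.Nat.Primality using (Prime; prime[2]; prime⇒irreducible; ¬prime[1]; productOfPrimes≥1)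
open import Data.Nat.Primality.Factorisation using (factorise; factorisationHasAllPrimeFactors)
open import Data.Nat.ListAction using (product)
open import Data.Nat.ListAction.Properties using (∈⇒∣product)
open import Data.Integer as ℤ using (ℤ; +_; 1ℤ)
import Data.Integer.Properties as ℤP
import Data.Integer.Divisibility as ℤD
import Data.Integer.Divisibility.Signed as ℤS
open import Data.Integer.GCD using (gcd)
open import Data.Integer.Tactic.RingSolver using (solve-∀)
open import Data.List using (List; []; _∷_; length; filter)
import Data.List.Properties as ListP
open import Data.List.Membership.Propositional using (_∈_; find)
open import Data.List.Membership.Propositional.Properties using (∈-filter⁺; ∈-filter⁻)
open import Data.List.Relation.Unary.All as All using (All; _∷_)
open import Data.List.Relation.Unary.Any as Any using (Any; here; there)
open import Data.List.Relation.Unary.Unique.Propositional using (Unique)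
import Data.List.Relation.Unary.Unique.Propositional.Properties as UniqueP
open import Data.List.Relation.Unary.AllPairs using (_∷_)
open import Data.Product using (∃; _,_; proj₁; proj₂)
open import Data.Sum using (_⊎_; inj₁; inj₂)
open import Data.Empty using (⊥-elim)
open import Function.Bundles using (mk⇔; Equivalence)
open import Relation.Binary.PropositionalEquality
open import Relation.Nullary using (¬_; yes; no; ¬?; contradiction)

parity : ∀ m → (∃ λ t → m ≡ t * 2) ⊎ (∃ λ t → m ≡ suc (t * 2))
parity zero = inj₁ (0 , refl)
parity (suc m) with parity m
... | inj₁ (t , m≡2t)   = inj₂ (t , cong suc m≡2t)
... | inj₂ (t , m≡2t+1) = inj₁ (suc t , cong suc m≡2t+1)

odd-form : ∀ {m} → Odd m → ∃ λ t → m ≡ suc (t * 2)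
odd-form {m} odd with parity m
... | inj₁ (t , m≡2t) = ⊥-elim (odd (divides t m≡2t))
... | inj₂ r          = r

2∤1 : ¬ (2 ∣ 1)
2∤1 2∣1 with ∣1⇒≡1 2∣1
... | ()

odd-suc : ∀ t → Odd (suc (t * 2))
odd-suc t 2∣2t+1 = 2∤1 (∣m+n∣m⇒∣n (subst (2 ∣_) (ℕP.+-comm 1 (t * 2)) 2∣2t+1) (divides t refl))

odd+odd : ∀ {m n} → Odd m → Odd n → 2 ∣ m + n
odd+odd om on with odd-form om | odd-form on
... | t , refl | u , refl = divides (suc (t + u)) (halves t u)
  where
  halves : ∀ t u → suc (t * 2) + suc (u * 2) ≡ suc (t + u) * 2
  halves = ℕSolver.solve-∀

OddInt : ℤ → Set
OddInt c = ¬ (+ 2 ℤS.∣ c)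

odd+even : ∀ {c} → OddInt c → ∀ j → OddInt (c ℤ.+ + 2 ℤ.* j)
odd+even c-odd j 2∣c+2j = c-odd (ℤS.∣m+n∣n⇒∣m 2∣c+2j (ℤS.∣m⇒∣m*n j ℤS.∣-refl))

oddNeighbour : ∀ a → ∃ λ c → OddInt c × (c ≡ a ⊎ 1ℤ ℤ.+ c ≡ a)
oddNeighbour a with + 2 ℤS.∣? a
... | no a-odd = a , a-odd , inj₁ refl
... | yes 2∣a  = ℤ.pred a , pred-odd , inj₂ (ℤP.suc-pred a)
  where
  pred-odd : OddInt (ℤ.pred a)
  pred-odd 2∣a-1 = 2∤1 (ℤS.∣⇒∣ᵤ (ℤS.∣m+n∣n⇒∣m {+ 2} {1ℤ} {ℤ.pred a}
    (subst (+ 2 ℤS.∣_) (sym (ℤP.suc-pred a)) 2∣a) 2∣a-1))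

oddMember : ∀ {a c M} → (c ≡ a ⊎ 1ℤ ℤ.+ c ≡ a) → ∀ {j} → 1 ≤ j → j ≤ M →
  ∃ λ x → 1 ≤ x × x ≤ M * 2 × a ℤ.+ + x ≡ c ℤ.+ + 2 ℤ.* + j
oddMember {c = c} (inj₁ refl) {j} 1≤j j≤M =
  j * 2 , ℕP.≤-trans 1≤j (ℕP.m≤m*n j 2) , ℕP.*-monoˡ-≤ 2 j≤M ,
  cong (λ i → c ℤ.+ i) (trans (ℤP.pos-* j 2) (ℤP.*-comm (+ j) (+ 2)))
oddMember {c = c} (inj₂ refl) {suc j} _ j<M =
  suc (j * 2) , s≤s z≤n , ℕP.≤-trans (ℕP.n≤1+n _) (ℕP.*-monoˡ-≤ 2 j<M) , window-identity
  where
  shift : ∀ c j → (1ℤ ℤ.+ c) ℤ.+ (1ℤ ℤ.+ j ℤ.* + 2) ≡ c ℤ.+ + 2 ℤ.* (1ℤ ℤ.+ j)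
  shift = solve-∀
  window-identity : (1ℤ ℤ.+ c) ℤ.+ + suc (j * 2) ≡ c ℤ.+ + 2 ℤ.* + suc j
  window-identity = begin
    (1ℤ ℤ.+ c) ℤ.+ + suc (j * 2)         ≡⟨ cong (λ i → (1ℤ ℤ.+ c) ℤ.+ i) odd-cast ⟩
    (1ℤ ℤ.+ c) ℤ.+ (1ℤ ℤ.+ + j ℤ.* + 2)  ≡⟨ shift c (+ j) ⟩
    c ℤ.+ + 2 ℤ.* (1ℤ ℤ.+ + j)           ≡⟨ cong (λ i → c ℤ.+ + 2 ℤ.* i) (sym (ℤP.pos-+ 1 j)) ⟩
    c ℤ.+ + 2 ℤ.* + suc j                ∎
    where
    open ≡-Reasoning
    odd-cast : + suc (j * 2) ≡ 1ℤ ℤ.+ + j ℤ.* + 2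
    odd-cast = trans (ℤP.pos-+ 1 (j * 2)) (cong (λ i → 1ℤ ℤ.+ i) (ℤP.pos-* j 2))

-- For odd Q, the integer h = (Q+1)/2 is an inverse of 2 modulo Q.
halfOfSuccessor : ∀ {Q} → Odd Q → ∃ λ h → h ℤ.* + 2 ≡ + Q ℤ.+ 1ℤ
halfOfSuccessor odd with odd-form odd
... | t , refl = + suc t , (begin
  + suc t ℤ.* + 2          ≡⟨ sym (ℤP.pos-* (suc t) 2) ⟩
  + suc (suc (t * 2))      ≡⟨ cong +_ (ℕP.+-comm 1 (suc (t * 2))) ⟩
  + (suc (t * 2) + 1)      ≡⟨ ℤP.pos-+ (suc (t * 2)) 1 ⟩
  + suc (t * 2) ℤ.+ 1ℤ     ∎)
  where open ≡-Reasoning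

-- Halving modulo Q: since h·(c+2j) = (h·c + j) + Q·j, a common divisor
-- of Q and c+2j divides h·c + j.
halving : ∀ h {Q} c j {p} → h ℤ.* + 2 ≡ + Q ℤ.+ 1ℤ → p ∣ Q →
  + p ℤS.∣ c ℤ.+ + 2 ℤ.* j → + p ℤS.∣ h ℤ.* c ℤ.+ j
halving h {Q} c j {p} h2 p∣Q p∣c+2j =
  ℤS.∣m+n∣n⇒∣m (subst (+ p ℤS.∣_) identity (ℤS.∣n⇒∣m*n h p∣c+2j))
               (ℤS.∣m⇒∣m*n j (ℤS.∣ᵤ⇒∣ {+ p} {+ Q} p∣Q))
  where
  open ≡-Reasoning
  expand : ∀ h c j → h ℤ.* (c ℤ.+ + 2 ℤ.* j) ≡ h ℤ.* c ℤ.+ (h ℤ.* + 2) ℤ.* j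
  expand = solve-∀
  regroup : ∀ h q c j → h ℤ.* c ℤ.+ (q ℤ.+ 1ℤ) ℤ.* j ≡ (h ℤ.* c ℤ.+ j) ℤ.+ q ℤ.* j
  regroup = solve-∀
  identity : h ℤ.* (c ℤ.+ + 2 ℤ.* j) ≡ (h ℤ.* c ℤ.+ j) ℤ.+ + Q ℤ.* j
  identity = begin
    h ℤ.* (c ℤ.+ + 2 ℤ.* j)            ≡⟨ expand h c j ⟩
    h ℤ.* c ℤ.+ (h ℤ.* + 2) ℤ.* j      ≡⟨ cong (λ i → h ℤ.* c ℤ.+ i ℤ.* j) h2 ⟩
    h ℤ.* c ℤ.+ (+ Q ℤ.+ 1ℤ) ℤ.* j     ≡⟨ regroup h (+ Q) c j ⟩
    (h ℤ.* c ℤ.+ j) ℤ.+ + Q ℤ.* j      ∎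

prime≢1 : ∀ {p} → Prime p → p ≢ 1
prime≢1 p-prime refl = ¬prime[1] p-prime

odd-prime : ∀ {p} → Prime p → p ≢ 2 → Odd p
odd-prime p-prime p≢2 2∣p with prime⇒irreducible p-prime 2∣p
... | inj₁ ()
... | inj₂ 2≡p = p≢2 (sym 2≡p)

primeFactor : ∀ g → g ≢ 0 → g ≢ 1 → ∃ λ p → Prime p × p ∣ g
primeFactor g g≢0 g≢1 with factorise g {{≢-nonZero g≢0}}
... | record { factors = [] ; isFactorisation = ∏≡g } = ⊥-elim (g≢1 ∏≡g)
... | record { factors = p ∷ ps ; isFactorisation = ∏≡g ; factorsPrime = p-prime ∷ _ } =
  p , p-prime , subst (p ∣_) (sym ∏≡g) (m∣m*n (product ps))

¬coprime⇒commonPrime : ∀ y {n} → 1 ≤ n → gcd y (+ n) ≢ + 1 →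
  ∃ λ p → Prime p × p ∣ n × + p ℤS.∣ y
¬coprime⇒commonPrime y {n} 1≤n gcd≢1
  with primeFactor (ℕGCD.gcd ℤ.∣ y ∣ n)
         (λ gcd≡0 → ℕP.<⇒≢ 1≤n (sym (ℕGCD.gcd[m,n]≡0⇒n≡0 ℤ.∣ y ∣ gcd≡0)))
         (λ gcd≡1 → gcd≢1 (cong +_ gcd≡1))
... | p , p-prime , p∣gcd =
  p , p-prime , ∣-trans p∣gcd (ℕGCD.gcd[m,n]∣n ℤ.∣ y ∣ n) ,
  ℤS.∣ᵤ⇒∣ (∣-trans p∣gcd (ℕGCD.gcd[m,n]∣m ℤ.∣ y ∣ n))

commonPrime⇒¬coprime : ∀ y {n p} → Prime p → p ∣ n → + p ℤS.∣ y → gcd y (+ n) ≢ + 1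
commonPrime⇒¬coprime y p-prime p∣n p∣y gcd≡1 =
  prime≢1 p-prime (∣1⇒≡1 (subst (_ ∣_) (ℤP.+-injective gcd≡1) (ℕGCD.gcd-greatest (ℤS.∣⇒∣ᵤ p∣y) p∣n)))

OddPrime : ℕ → Set
OddPrime p = Prime p × Odd p

product-odd : ∀ {ps} → All OddPrime ps → Odd (product ps)
product-odd oddPrimes 2∣∏ =
  proj₂ (All.lookup oddPrimes (factorisationHasAllPrimeFactors prime[2] 2∣∏ (All.map proj₁ oddPrimes))) ∣-refl

length-without : ∀ {x xs} → Unique xs → x ∈ xs →
  suc (length (filter (λ y → ¬? (y ≟ x)) xs)) ≡ length xs
length-without {x} {_ ∷ xs} (x∉xs ∷ _) (here refl) = cong (λ l → suc (length l)) (begin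
  filter ≢x? (x ∷ xs) ≡⟨ ListP.filter-reject ≢x? (λ x≢x → x≢x refl) ⟩
  filter ≢x? xs       ≡⟨ ListP.filter-all ≢x? (All.map (λ x≢y y≡x → x≢y (sym y≡x)) x∉xs) ⟩
  xs                 ∎)
  where
  open ≡-Reasoning
  ≢x? = λ y → ¬? (y ≟ x)
length-without {x} {y ∷ _} (y∉ys ∷ uniq) (there x∈ys) =
  trans (cong (λ l → suc (length l)) (ListP.filter-accept (λ z → ¬? (z ≟ x)) y≢x))
        (cong suc (length-without uniq x∈ys))
  where
  y≢x : y ≢ x
  y≢x refl = All.lookup y∉ys x∈ys refl

OddPrimeDivisors : ℕ → ℕ → List ℕ → Set
OddPrimeDivisors n k qs =
  length qs ≡ k ∸ 1 × Unique qs × All OddPrime qs ×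
  (∀ {p} → Prime p → p ∣ n → Odd p → p ∈ qs)

oddPrimeDivisors : ∀ {n k} → 2 ∣ n → NumDistinctPrimeDivisors n k → ∃ (OddPrimeDivisors n k)
oddPrimeDivisors {n} 2∣n (ps , uniq , length≡k , primeDivisor) =
  qs , cong (_∸ 1) (trans (length-without uniq 2∈ps) length≡k) , UniqueP.filter⁺ ≢2? uniq ,
  All.tabulate odd-prime-of , complete
  where
  ≢2? = λ p → ¬? (p ≟ 2)
  qs = filter ≢2? ps
  2∈ps : 2 ∈ ps
  2∈ps = Equivalence.from (primeDivisor 2) (prime[2] , 2∣n)
  odd-prime-of : ∀ {p} → p ∈ qs → OddPrime p
  odd-prime-of p∈qs with ∈-filter⁻ ≢2? p∈qs
  ... | p∈ps , p≢2 = p-prime , odd-prime p-prime p≢2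
    where
    p-prime = proj₁ (Equivalence.to (primeDivisor _) p∈ps)
  complete : ∀ {p} → Prime p → p ∣ n → Odd p → p ∈ qs
  complete p-prime p∣n p-odd =
    ∈-filter⁺ ≢2? (Equivalence.from (primeDivisor _) (p-prime , p∣n)) (λ { refl → p-odd ∣-refl })

primeDivisors-double : ∀ {ps} → Unique ps → All OddPrime ps →
  NumDistinctPrimeDivisors (2 * product ps) (suc (length ps))
primeDivisors-double {ps} uniq oddPrimes = 2 ∷ ps , 2∉ps ∷ uniq , refl , λ p → mk⇔ (to p) from
  where
  primes : All Prime (2 ∷ ps)
  primes = prime[2] ∷ All.map proj₁ oddPrimes
  2∉ps : All (2 ≢_) ps
  2∉ps = All.map (λ { (_ , p-odd) refl → p-odd ∣-refl }) oddPrimes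
  to : ∀ p → p ∈ 2 ∷ ps → Prime p × p ∣ 2 * product ps
  to p p∈ = All.lookup primes p∈ , ∈⇒∣product p∈
  from : ∀ {p} → Prime p × p ∣ 2 * product ps → p ∈ 2 ∷ ps
  from (p-prime , p∣n) = factorisationHasAllPrimeFactors p-prime p∣n primes

CoprimeFree : ℕ → ℤ → ℕ → Set
CoprimeFree n a m = ∀ x → 1 ≤ x → x ≤ m → gcd (a ℤ.+ + x) (+ n) ≢ + 1

-- Coprimality is decidable, so if no window of length m is coprime-free,
-- every such window exhibits a coprime element.
jacobsthal-if-noFreeWindow : ∀ {n m} → (∀ a → ¬ CoprimeFree n a m) → JacobsthalProp n m
jacobsthal-if-noFreeWindow {n} {m} noFree a
  with ℕP.anyUpTo? (λ y → gcd (a ℤ.+ + suc y) (+ n) ℤP.≟ + 1) m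
... | yes (y , y<m , coprime) = suc y , s≤s z≤n , y<m , coprime
... | no noCoprime = ⊥-elim (noFree a free)
  where
  free : CoprimeFree n a m
  free (suc y) _ y<m coprime = noCoprime (y , y<m , coprime)

freeWindow⇒< : ∀ {n m a L} → JacobsthalProp n m → CoprimeFree n a L → L < m
freeWindow⇒< {m = m} {a} {L} jac free with m ≤? L
... | no m≰L = ℕP.≰⇒> m≰L
... | yes m≤L with jac a
...   | x , 1≤x , x≤m , coprime = contradiction coprime (free x 1≤x (ℕP.≤-trans x≤m m≤L))

freeWindow⇒omega : ∀ {n k M a} → 1 ≤ n → 2 ∣ n → NumDistinctPrimeDivisors n k →
  CoprimeFree n a (M * 2) → OmegaProp k M
freeWindow⇒omega {n} {k} {M} {a} 1≤n 2∣n nd free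
  with oddPrimeDivisors 2∣n nd | oddNeighbour a
... | qs , length≡ , uniq , oddPrimes , complete | c , c-odd , near
  with halfOfSuccessor (product-odd oddPrimes)
... | h , h2 = h ℤ.* c , qs , length≡ , uniq , oddPrimes , cover
  where
  cover : ∀ j → 1 ≤ j → j ≤ M → Any (λ p → + p ℤD.∣ h ℤ.* c ℤ.+ + j) qs
  cover j 1≤j j≤M with oddMember near 1≤j j≤M
  ... | x , 1≤x , x≤2M , a+x≡c+2j
    with ¬coprime⇒commonPrime (c ℤ.+ + 2 ℤ.* + j) 1≤n
           (subst (λ y → gcd y (+ n) ≢ + 1) a+x≡c+2j (free x 1≤x x≤2M))
  ...   | p , p-prime , p∣n , p∣c+2j = Any.map (λ { refl → p∣hc+j }) p∈qs
    where
    p-odd : Odd p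
    p-odd 2∣p = odd+even c-odd (+ j) (ℤS.∣-trans (ℤS.∣ᵤ⇒∣ 2∣p) p∣c+2j)
    p∈qs : p ∈ qs
    p∈qs = complete p-prime p∣n p-odd
    p∣hc+j : + p ℤD.∣ h ℤ.* c ℤ.+ + j
    p∣hc+j = ℤS.∣⇒∣ᵤ (halving h c (+ j) h2 (∈⇒∣product p∈qs) p∣c+2j)

-- In the window after 2a + P, with P odd, an odd offset 2t+1 gives an
-- even integer.
odd-offset : ∀ a {P} → Odd P → ∀ t →
  gcd ((+ 2 ℤ.* a ℤ.+ + P) ℤ.+ + suc (t * 2)) (+ (2 * P)) ≢ + 1
odd-offset a {P} P-odd t = commonPrime⇒¬coprime y prime[2] (m∣m*n P) 2∣y
  where
  y = (+ 2 ℤ.* a ℤ.+ + P) ℤ.+ + suc (t * 2)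
  regroup : y ≡ + 2 ℤ.* a ℤ.+ + (P + suc (t * 2))
  regroup = trans (ℤP.+-assoc (+ 2 ℤ.* a) (+ P) (+ suc (t * 2)))
                  (cong (λ i → + 2 ℤ.* a ℤ.+ i) (sym (ℤP.pos-+ P (suc (t * 2)))))
  2∣y : + 2 ℤS.∣ y
  2∣y = subst (+ 2 ℤS.∣_) (sym regroup)
    (ℤS.∣m∣n⇒∣m+n (ℤS.∣m⇒∣m*n a ℤS.∣-refl)
                  (ℤS.∣ᵤ⇒∣ {+ 2} {+ (P + suc (t * 2))} (odd+odd P-odd (odd-suc t))))

-- In the same window, an even offset 2t gives 2(a+t) + P, which shares
-- with 2P any prime p dividing both P and a+t.
even-offset : ∀ a {P p} → Prime p → p ∣ P → ∀ t → + p ℤD.∣ a ℤ.+ + t →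
  gcd ((+ 2 ℤ.* a ℤ.+ + P) ℤ.+ + (t * 2)) (+ (2 * P)) ≢ + 1
even-offset a {P} {p} p-prime p∣P t p∣a+t =
  commonPrime⇒¬coprime y p-prime (∣n⇒∣m*n 2 p∣P) p∣y
  where
  y = (+ 2 ℤ.* a ℤ.+ + P) ℤ.+ + (t * 2)
  rearrange : ∀ a P t → (+ 2 ℤ.* a ℤ.+ P) ℤ.+ t ℤ.* + 2 ≡ + 2 ℤ.* (a ℤ.+ t) ℤ.+ P
  rearrange = solve-∀
  regroup : y ≡ + 2 ℤ.* (a ℤ.+ + t) ℤ.+ + P
  regroup = trans (cong (λ i → (+ 2 ℤ.* a ℤ.+ + P) ℤ.+ i) (ℤP.pos-* t 2))
                  (rearrange a (+ P) (+ t))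
  p∣y : + p ℤS.∣ y
  p∣y = subst (+ p ℤS.∣_) (sym regroup)
    (ℤS.∣m∣n⇒∣m+n (ℤS.∣n⇒∣m*n (+ 2) (ℤS.∣ᵤ⇒∣ {+ p} {a ℤ.+ + t} p∣a+t))
                  (ℤS.∣ᵤ⇒∣ {+ p} {+ P} p∣P))

half-≤ : ∀ {t w} → t * 2 ≤ suc (w * 2) → t ≤ w
half-≤ 2t≤2w+1 = ℕP.≤-pred (ℕP.*-cancelʳ-< _ _ _ (s≤s 2t≤2w+1))

doubledWindow : ∀ {a ps w} → All OddPrime ps →
  (∀ x → 1 ≤ x → x ≤ w → Any (λ p → + p ℤD.∣ a ℤ.+ + x) ps) →
  CoprimeFree (2 * product ps) (+ 2 ℤ.* a ℤ.+ + product ps) (suc (w * 2))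
doubledWindow {a} {ps} {w} oddPrimes cover x 1≤x x≤2w+1 with parity x
... | inj₂ (t , refl)     = odd-offset a (product-odd oddPrimes) t
... | inj₁ (zero , refl)  = contradiction 1≤x λ ()
... | inj₁ (suc t , refl) with find (cover (suc t) (s≤s z≤n) (half-≤ x≤2w+1))
...   | p , p∈ps , p∣a+t =
  even-offset a (proj₁ (All.lookup oddPrimes p∈ps)) (∈⇒∣product p∈ps) (suc t) p∣a+t

double-suc : ∀ w → 2 * w + 2 ≡ suc w * 2
double-suc = ℕSolver.solve-∀

lemma2 : ∀ (k : ℕ) → 2 ≤ k → ∀ (w : ℕ) → IsOmega k w →
    (Σ ℕ λ n → 1 ≤ n × 2 ∣ n × NumDistinctPrimeDivisors n k ×
    IsJacobsthal n (2 * w + 2))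
    × (∀ (n m : ℕ) → 1 ≤ n → 2 ∣ n → NumDistinctPrimeDivisors n k →
    IsJacobsthal n m → m ≤ 2 * w + 2)
lemma2 zero () _ _
lemma2 k@(suc _) _ w (_ , (a , ps , length≡ , uniq , oddPrimes , cover) , maximal) =
  (n , 1≤n , 2∣n , nd , 1≤2w+2 , jacobsthal 1≤n 2∣n nd , minimal) ,
  λ _ _ 1≤n′ 2∣n′ nd′ (_ , _ , least) → least _ 1≤2w+2 (jacobsthal 1≤n′ 2∣n′ nd′)
  where
  n = 2 * product ps
  2∣n : 2 ∣ n
  2∣n = m∣m*n (product ps)
  2w+2≡ : 2 * w + 2 ≡ suc w * 2
  2w+2≡ = double-suc w
  1≤2w+2 : 1 ≤ 2 * w + 2
  1≤2w+2 = subst (1 ≤_) (sym 2w+2≡) (s≤s z≤n)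
  1≤n : 1 ≤ n
  1≤n = productOfPrimes≥1 (prime[2] ∷ All.map proj₁ oddPrimes)
  nd : NumDistinctPrimeDivisors n k
  nd = subst (NumDistinctPrimeDivisors n) (cong suc length≡) (primeDivisors-double uniq oddPrimes)
  -- every even n with d_P(n) = k has j(n) ≤ 2w+2, since w+1 > Ω(k)
  jacobsthal : ∀ {n′} → 1 ≤ n′ → 2 ∣ n′ → NumDistinctPrimeDivisors n′ k →
    JacobsthalProp n′ (2 * w + 2)
  jacobsthal {n′} 1≤n′ 2∣n′ nd′ = jacobsthal-if-noFreeWindow λ b free →
    ℕP.n≮n w (maximal (suc w)
      (freeWindow⇒omega {M = suc w} {a = b} 1≤n′ 2∣n′ nd′ (subst (CoprimeFree n′ b) 2w+2≡ free)))
  -- the doubled window of length 2w+1 shows j(n) ≥ 2w+2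
  minimal : ∀ m → 1 ≤ m → JacobsthalProp n m → 2 * w + 2 ≤ m
  minimal m _ jac = subst (_≤ m) (sym 2w+2≡)
    (freeWindow⇒< {a = + 2 ℤ.* a ℤ.+ + product ps} jac (doubledWindow {a = a} {w = w} oddPrimes cover))
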